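{- In $\mathbb{Z}^{18}$, the $10$-icube formed by the vectors $(1,1,1,\dots,1)^T$, $(3,-3,0,0,\dots,0,0)^T$, $(0,0,3,-3,0,\dots,0)^T$, $\dots$, $(0,\dots,0,3,-3)^T$ (all of norm $18$) cannot be extended to an $11$-icube.
   Context: For $1\le k\le n$, a matrix $(v_1|\dots|v_k)\in\mathbb{Z}^{n\times k}$ is a $k$-icube of norm $\lambda>0$ if $v_i^Tv_j=\lambda$ for $i=j$ and $0$ for $i\ne j$. An $\ell$-icube $A$ can be extended to a $k$-icube ($\ell<k$) if some $\ell$ columns of some $k$-icube form $A$. -}

module Defs where

open import Data.Nat using (ℕ; zero; suc)
open import Data.Fin using (Fin; zero; suc; toℕ)
open import Data.Integer using (ℤ; +_; -_; _*_; _+_; _>_)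
open import Data.Product using (Σ; _×_; ∃-syntax)
open import Relation.Binary.PropositionalEquality using (_≡_; _≢_)
open import Function.Definitions using (Injective)

dot : {n : ℕ} → (Fin n → ℤ) → (Fin n → ℤ) → ℤ
dot {zero}  u v = + 0
dot {suc n} u v = u zero * v zero + dot (λ i → u (suc i)) (λ i → v (suc i))

-- an n×k integer matrix, represented by its k columns (each in ℤ^n)
Matrix : ℕ → ℕ → Set
Matrix n k = Fin k → (Fin n → ℤ)

IsIcube : {n k : ℕ} → ℤ → Matrix n k → Set
IsIcube {n} {k} λ' M =
  (λ' > + 0) ×
  ((i : Fin k) → dot (M i) (M i) ≡ λ') ×
  ((i j : Fin k) → i ≢ j → dot (M i) (M j) ≡ + 0)

ExtendsTo : {n ℓ : ℕ} → Matrix n ℓ → (k : ℕ) → Set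
ExtendsTo {n} {ℓ} A k =
  ∃[ λ' ] ∃[ B ] ∃[ σ ]
    (IsIcube {n} {k} λ' B × Injective _≡_ _≡_ σ × ((i : Fin ℓ) → B (σ i) ≡ A i))

-- The specific 10-icube in ℤ^18 of norm 18:
-- column 0 = (1,…,1); column j (1 ≤ j ≤ 9) has 3 at coordinate 2(j-1),
-- -3 at coordinate 2(j-1)+1 (0-based), and 0 elsewhere.
pairEntry : ℕ → ℕ → ℤ
pairEntry zero    zero          = + 3
pairEntry zero    (suc zero)    = - (+ 3)
pairEntry zero    (suc (suc r)) = + 0
pairEntry (suc j) zero          = + 0
pairEntry (suc j) (suc zero)    = + 0
pairEntry (suc j) (suc (suc r)) = pairEntry j r

cube10 : Matrix 18 10
cube10 zero    r = + 1
cube10 (suc j) r = pairEntry (toℕ j) (toℕ r)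

{-# OPTIONS --safe #-}
-- A column w completing the cube to an 11-icube is orthogonal to every column of cube10 and has
-- norm 18. Orthogonality to the nine (3,-3) columns forces w = (a₁,a₁,…,a₉,a₉), and orthogonality
-- to (1,…,1) gives 2 Σ aⱼ = 0. Since a² ≡ a (mod 2), the norm 2 Σ aⱼ² ≡ 2 Σ aⱼ = 0 (mod 4),
-- contradicting 18 ≢ 0 (mod 4).
module Submission where

open import Defs
open import Data.Integer using (+_)
open import Data.Product using (_×_)
open import Relation.Nullary using (¬_)

open import Data.Nat as ℕ using (ℕ; zero; suc)
open import Data.Nat.Properties using (n<1+n)
open import Data.Fin using (Fin; zero; suc; toℕ)
open import Data.Fin.Properties as Finₚ using (all?; any?; ¬∀⟶∃¬; pigeonhole)
open import Data.Integer using (ℤ; _*_; _+_; _-_; -_)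
import Data.Integer.Properties as ℤ
open import Data.Integer.DivMod using (_%ℕ_; _/ℕ_; n%ℕd<d; a≡a%ℕn+[a/ℕn]*n)
open import Data.Integer.Divisibility.Signed using (_∣_; divides; _∣?_; ∣m∣n⇒∣m+n; *-monoʳ-∣)
open import Data.Integer.Tactic.RingSolver using (solve-∀)
open import Data.Product using (Σ-syntax; ∃-syntax; _,_; proj₁; proj₂)
open import Data.Unit using (⊤; tt)
open import Relation.Nullary using (Dec; yes; no; contradiction)
open import Relation.Nullary.Decidable using (_×-dec_; _→-dec_; ¬?; from-yes; from-no)
open import Relation.Binary.PropositionalEquality using (_≡_; _≢_; refl; sym; trans; cong; cong₂; subst; module ≡-Reasoning)

isIcube? : ∀ {n k} (λ' : ℤ) (M : Matrix n k) → Dec (IsIcube λ' M)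
isIcube? λ' M =
  (+ 0 ℤ.<? λ') ×-dec
  all? (λ i → dot (M i) (M i) ℤ.≟ λ') ×-dec
  all? (λ i → all? (λ j → ¬? (i Finₚ.≟ j) →-dec dot (M i) (M j) ℤ.≟ + 0))

<⇒∃-outside-image : ∀ {ℓ k} → ℓ ℕ.< k → (σ : Fin ℓ → Fin k) → ∃[ j ] (∀ i → σ i ≢ j)
<⇒∃-outside-image ℓ<k σ with all? (λ j → any? (λ i → σ i Finₚ.≟ j))
... | yes onto =
  let i , j , i<j , same = pigeonhole ℓ<k (λ j → proj₁ (onto j))
  in  contradiction (trans (sym (proj₂ (onto i))) (trans (cong σ same) (proj₂ (onto j))))
                    (Finₚ.<⇒≢ i<j)
... | no ¬onto =
  let j , unhit = ¬∀⟶∃¬ _ _ (λ j → any? (λ i → σ i Finₚ.≟ j)) ¬onto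
  in  j , λ i σi≡j → unhit (i , σi≡j)

extendsTo⇒orthogonalColumn : ∀ {n ℓ k} {A : Matrix n ℓ} → ℓ ℕ.< k → ExtendsTo A k →
  Σ[ w ∈ (Fin n → ℤ) ] ((∀ i → dot (A i) w ≡ + 0) × (∀ i → dot w w ≡ dot (A i) (A i)))
extendsTo⇒orthogonalColumn {A = A} ℓ<k (_ , B , σ , (_ , norm , orth) , _ , col)
  with j , missed ← <⇒∃-outside-image ℓ<k σ =
  B j , orthogonal , sameNorm
  where
  orthogonal : ∀ i → dot (A i) (B j) ≡ + 0
  orthogonal i = subst (λ v → dot v (B j) ≡ + 0) (col i) (orth (σ i) j (missed i))
  sameNorm : ∀ i → dot (B j) (B j) ≡ dot (A i) (A i)
  sameNorm i = trans (norm j) (trans (sym (norm (σ i))) (cong (λ v → dot v v) (col i)))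

2∣a*a-a : ∀ a → + 2 ∣ a * a - a
2∣a*a-a a with a %ℕ 2 | n%ℕd<d a 2 | a≡a%ℕn+[a/ℕn]*n a 2
... | 0 | _ | a≡2q =
  subst (λ x → + 2 ∣ x * x - x) (sym a≡2q) (divides (+ 2 * q * q - q) (even q))
  where
  q : ℤ
  q = a /ℕ 2
  even : ∀ p → (+ 0 + p * + 2) * (+ 0 + p * + 2) - (+ 0 + p * + 2) ≡ (+ 2 * p * p - p) * + 2
  even = solve-∀
... | 1 | _ | a≡2q+1 =
  subst (λ x → + 2 ∣ x * x - x) (sym a≡2q+1) (divides (+ 2 * q * q + q) (odd q))
  where
  q : ℤ
  q = a /ℕ 2
  odd : ∀ p → (+ 1 + p * + 2) * (+ 1 + p * + 2) - (+ 1 + p * + 2) ≡ (+ 2 * p * p + p) * + 2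
  odd = solve-∀
... | suc (suc _) | ℕ.s≤s (ℕ.s≤s ()) | _

-- Not 2 * m: Fin (double (suc m)) has to reduce to Fin (suc (suc _)).
double : ℕ → ℕ
double zero    = zero
double (suc m) = suc (suc (double m))

pairColumn : ∀ {m} → Fin m → Fin (double m) → ℤ
pairColumn j r = pairEntry (toℕ j) (toℕ r)

Paired : ∀ {m} → (Fin (double m) → ℤ) → Set
Paired {zero}  w = ⊤
Paired {suc m} w = w zero ≡ w (suc zero) × Paired (λ r → w (suc (suc r)))

dot-zeroˡ : ∀ {n} (w : Fin n → ℤ) → dot (λ _ → + 0) w ≡ + 0
dot-zeroˡ {zero}  w = refl
dot-zeroˡ {suc n} w = trans (ℤ.+-identityˡ _) (dot-zeroˡ (λ r → w (suc r)))

orthogonal⇒Paired : ∀ {m} (w : Fin (double m) → ℤ) →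
                    (∀ j → dot (pairColumn j) w ≡ + 0) → Paired w
orthogonal⇒Paired {zero}  w _    = tt
orthogonal⇒Paired {suc m} w orth =
  firstPairEqual ,
  orthogonal⇒Paired (λ r → w (suc (suc r))) (λ j → trans (sym (shift j)) (orth (suc j)))
  where
  firstPairEqual : w zero ≡ w (suc zero)
  firstPairEqual = ℤ.i-j≡0⇒i≡j _ _ (ℤ.*-cancelˡ-≡ (+ 3) _ (+ 0) (begin
    + 3 * (w zero - w (suc zero))                ≡⟨ expand (w zero) (w (suc zero)) ⟩
    + 3 * w zero + (- + 3 * w (suc zero) + + 0)  ≡⟨ cong (λ z → + 3 * w zero + (- + 3 * w (suc zero) + z))
                                                         (sym (dot-zeroˡ (λ r → w (suc (suc r))))) ⟩
    dot (pairColumn zero) w                      ≡⟨ orth zero ⟩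
    + 0                                          ∎))
    where
    open ≡-Reasoning
    expand : ∀ a b → + 3 * (a - b) ≡ + 3 * a + (- + 3 * b + + 0)
    expand = solve-∀
  shift : ∀ j → dot (pairColumn (suc j)) w ≡ dot (pairColumn j) (λ r → w (suc (suc r)))
  shift j = trans (ℤ.+-identityˡ _) (ℤ.+-identityˡ _)

Paired⇒4∣norm-sum : ∀ {m} (w : Fin (double m) → ℤ) → Paired w → + 4 ∣ dot w w - dot (λ _ → + 1) w
Paired⇒4∣norm-sum {zero}  w _                = divides (+ 0) refl
Paired⇒4∣norm-sum {suc m} w (w₀≡w₁ , paired) =
  pairStep w₀≡w₁ (2∣a*a-a (w zero)) (Paired⇒4∣norm-sum (λ r → w (suc (suc r))) paired)
  where
  split : ∀ a D O → a * a + (a * a + D) - (+ 1 * a + (+ 1 * a + O)) ≡ + 2 * (a * a - a) + (D - O)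
  split = solve-∀
  pairStep : ∀ {a b D O} → a ≡ b → + 2 ∣ a * a - a → + 4 ∣ D - O →
             + 4 ∣ a * a + (b * b + D) - (+ 1 * a + (+ 1 * b + O))
  pairStep {a} {D = D} {O} refl 2∣a²-a 4∣D-O =
    subst (+ 4 ∣_) (sym (split a D O)) (∣m∣n⇒∣m+n (*-monoʳ-∣ (+ 2) 2∣a²-a) 4∣D-O)

4∤18 : ¬ + 4 ∣ + 18
4∤18 = from-no (+ 4 ∣? + 18)

cube10-orthogonal⇒norm≢18 : (w : Fin 18 → ℤ) → (∀ i → dot (cube10 i) w ≡ + 0) → dot w w ≢ + 18
cube10-orthogonal⇒norm≢18 w orth norm≡18 = 4∤18 (subst (+ 4 ∣_) norm-sum≡18 4∣norm-sum)
  where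
  4∣norm-sum : + 4 ∣ dot w w - dot (λ _ → + 1) w
  4∣norm-sum = Paired⇒4∣norm-sum w (orthogonal⇒Paired w (λ j → orth (suc j)))
  norm-sum≡18 : dot w w - dot (λ _ → + 1) w ≡ + 18
  norm-sum≡18 = cong₂ _-_ norm≡18 (orth zero)

mainTheorem15 : IsIcube (+ 18) cube10 × ¬ ExtendsTo cube10 11
mainTheorem15 = from-yes (isIcube? (+ 18) cube10) , λ ext →
  let w , orth , sameNorm = extendsTo⇒orthogonalColumn (n<1+n 10) ext
  in  cube10-orthogonal⇒norm≢18 w orth (sameNorm zero)
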